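{- For all $m,r\in\mathbb{N}$ and every word $w=y_rw'$ in the free monoid on $Y=\{y_0,y_1,\ldots\}$ (with $w'$ an arbitrary, possibly empty, word), $$\mathrm{Li}^-_{y_m}\,\mathrm{Li}^-_{w}=\sum_{k=0}^m(-1)^k\binom{m}{k}\mathrm{Li}^-_{y_{m-k}y_{r+k}w'} .$$
   Context: $\mathbb{N}$ is the set of non-negative integers. For $r\ge0$ and $\mathbf{s}=(s_1,\ldots,s_r)\in\mathbb{N}^r$ put $\mathrm{Li}^-_{\mathbf{s}}(z):=\sum_{n_1>\cdots>n_r>0}n_1^{s_1}\cdots n_r^{s_r}z^{n_1}$ for $|z|<1$ (the empty index gives $1$); each is a rational function in $\mathbb{Q}[z,(1-z)^{ -1}]$, and products are products of these functions. For a word $w=y_{s_1}\cdots y_{s_r}$ in the free monoid on $Y$ set $\mathrm{Li}^-_w:=\mathrm{Li}^-_{(s_1,\ldots,s_r)}$, and $\mathrm{Li}^-_w:=1$ for the empty word. -}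

module Defs where

open import Data.Nat as ℕ using (ℕ; zero; suc; _∸_)
open import Data.Nat.Combinatorics using (_C_)
open import Data.Integer using (ℤ; +_; -_; _+_; _*_)
open import Data.List using (List; []; _∷_)

-- Words in the free monoid on Y = {y_0, y_1, ...}: y_{s_1} ... y_{s_r} ↦ s_1 ∷ ... ∷ s_r ∷ []
Word : Set
Word = List ℕ

-- Formal power series in z with integer coefficients: n ↦ coefficient of z^n.
Series : Set
Series = ℕ → ℤ

sumBelow : (ℕ → ℤ) → ℕ → ℤ
sumBelow f zero    = + 0
sumBelow f (suc n) = sumBelow f n + f n

_⊛_ : Series → Series → Series
(f ⊛ g) N = sumBelow (λ a → f a * g (N ∸ a)) (suc N)

-- Coefficients of Li^-_w(z) = Σ_{n_1>...>n_r>0} n_1^{s_1}...n_r^{s_r} z^{n_1}.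
-- coeffLi [] = 1 (constant series), and for w = y_s w',
--   [z^0] = 0,  [z^{n}] = n^s · Σ_{k<n} [z^k] Li^-_{w'}   (n ≥ 1),
-- which unfolds to Σ_{n>n_2>...>n_r>0} n^{s} n_2^{s_2} ... n_r^{s_r}.
coeffLi : Word → Series
coeffLi []      zero    = + 1
coeffLi []      (suc n) = + 0
coeffLi (s ∷ w) zero    = + 0
coeffLi (s ∷ w) (suc n) = + (suc n ℕ.^ s) * sumBelow (coeffLi w) (suc n)

sign : ℕ → ℤ
sign zero    = + 1
sign (suc k) = - sign k

{-# OPTIONS --safe #-}
-- On coefficients, Li⁻_{y_r w′} has [z^b] = b^r H(b) with H(b) = Σ_{j<b} [z^j] Li⁻_{w′},
-- and Li⁻_{y_m} has [z^a] = a^m for a > 0, so [z^N] of the product is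
-- Σ_{b<N} (N - b)^m b^r H(b). Expanding (N - b)^m by the binomial theorem gives
-- Σ_k (-1)^k (m choose k) N^(m-k) Σ_{b<N} b^(r+k) H(b), and the inner sum times
-- N^(m-k) is exactly [z^N] Li⁻_{y_{m-k} y_{r+k} w′}.
module Submission where

open import Defs
open import Data.Nat using (ℕ; zero; suc; _∸_; _≤_; _<_) renaming (_+_ to _+ℕ_; _*_ to _ℕ*_; _^_ to _^ℕ_)
open import Data.Nat.Properties using (n<1+n; m<n⇒m<1+n; <⇒≤; m<n⇒0<n∸m; m∸[m∸n]≡n; n∸n≡0; ^-distribˡ-+-*)
open import Data.Nat.Combinatorics using (_C_)
open import Data.Fin using (Fin; toℕ)
open import Data.Integer using (ℤ; +_; -_; _+_; _*_; _^_)
open import Data.Integer.Properties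
  using (+-0-monoid; +-*-commutativeSemiring; +-identityˡ; +-identityʳ; +-assoc; +-comm; *-identityʳ; *-zeroˡ; *-zeroʳ; *-assoc; *-distribˡ-+; *-distribʳ-+; pos-*; -m+n≡n⊖m; ⊖-≥)
open import Data.Integer.Solver using (module +-*-Solver)
open import Data.List using (_∷_; [])
open import Algebra.Bundles using (CommutativeSemiring)
open import Algebra.Properties.Monoid.Sum +-0-monoid using (sum; sum-cong-≗)
open import Algebra.Definitions.RawMonoid (CommutativeSemiring.+-rawMonoid +-*-commutativeSemiring) using (_×_)
open import Algebra.Properties.Semiring.Exp (CommutativeSemiring.semiring +-*-commutativeSemiring)
  using () renaming (_^_ to _^ₛ_)
import Algebra.Properties.CommutativeSemiring.Binomial +-*-commutativeSemiring as Binomial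
open import Relation.Binary.PropositionalEquality using (_≡_; refl; sym; trans; cong; cong₂; module ≡-Reasoning)

open +-*-Solver
open ≡-Reasoning

sumBelow-cong : ∀ {f g : ℕ → ℤ} n → (∀ i → i < n → f i ≡ g i) → sumBelow f n ≡ sumBelow g n
sumBelow-cong zero    f≗g = refl
sumBelow-cong (suc n) f≗g = cong₂ _+_ (sumBelow-cong n (λ i i<n → f≗g i (m<n⇒m<1+n i<n))) (f≗g n (n<1+n n))

sumBelow-0 : ∀ n → sumBelow (λ _ → + 0) n ≡ + 0
sumBelow-0 zero    = refl
sumBelow-0 (suc n) = trans (+-identityʳ (sumBelow (λ _ → + 0) n)) (sumBelow-0 n)

sumBelow-suc : ∀ (f : ℕ → ℤ) n → sumBelow f (suc n) ≡ f 0 + sumBelow (λ i → f (suc i)) n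
sumBelow-suc f zero    = trans (+-identityˡ (f 0)) (sym (+-identityʳ (f 0)))
sumBelow-suc f (suc n) = trans (cong (_+ f (suc n)) (sumBelow-suc f n)) (+-assoc (f 0) _ _)

sumBelow-reverse : ∀ (f : ℕ → ℤ) n → sumBelow f (suc n) ≡ sumBelow (λ i → f (n ∸ i)) (suc n)
sumBelow-reverse f zero    = refl
sumBelow-reverse f (suc n) = begin
  sumBelow f (suc n) + f (suc n)                 ≡⟨ cong (_+ f (suc n)) (sumBelow-reverse f n) ⟩
  sumBelow (λ i → f (n ∸ i)) (suc n) + f (suc n) ≡⟨ +-comm (sumBelow (λ i → f (n ∸ i)) (suc n)) (f (suc n)) ⟩
  f (suc n) + sumBelow (λ i → f (n ∸ i)) (suc n) ≡⟨ sym (sumBelow-suc (λ i → f (suc n ∸ i)) (suc n)) ⟩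
  sumBelow (λ i → f (suc n ∸ i)) (suc (suc n))   ∎

sumBelow-distrib-+ : ∀ (f g : ℕ → ℤ) n → sumBelow (λ i → f i + g i) n ≡ sumBelow f n + sumBelow g n
sumBelow-distrib-+ f g zero    = refl
sumBelow-distrib-+ f g (suc n) = trans (cong (_+ (f n + g n)) (sumBelow-distrib-+ f g n))
  (solve 4 (λ a b c d → (a :+ b) :+ (c :+ d) := (a :+ c) :+ (b :+ d)) refl (sumBelow f n) (sumBelow g n) (f n) (g n))

sumBelow-comm : ∀ (F : ℕ → ℕ → ℤ) m n →
  sumBelow (λ i → sumBelow (F i) n) m ≡ sumBelow (λ j → sumBelow (λ i → F i j) m) n
sumBelow-comm F zero    n = sym (sumBelow-0 n)
sumBelow-comm F (suc m) n = trans (cong (_+ sumBelow (F m) n) (sumBelow-comm F m n))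
  (sym (sumBelow-distrib-+ (λ j → sumBelow (λ i → F i j) m) (F m) n))

*-distribˡ-sumBelow : ∀ c (f : ℕ → ℤ) n → c * sumBelow f n ≡ sumBelow (λ i → c * f i) n
*-distribˡ-sumBelow c f zero    = *-zeroʳ c
*-distribˡ-sumBelow c f (suc n) =
  trans (*-distribˡ-+ c (sumBelow f n) (f n)) (cong (_+ c * f n) (*-distribˡ-sumBelow c f n))

*-distribʳ-sumBelow : ∀ c (f : ℕ → ℤ) n → sumBelow f n * c ≡ sumBelow (λ i → f i * c) n
*-distribʳ-sumBelow c f zero    = *-zeroˡ c
*-distribʳ-sumBelow c f (suc n) =
  trans (*-distribʳ-+ c (sumBelow f n) (f n)) (cong (_+ f n * c) (*-distribʳ-sumBelow c f n))

sumBelow≡sum : ∀ (f : ℕ → ℤ) n → sumBelow f n ≡ sum (λ (i : Fin n) → f (toℕ i))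
sumBelow≡sum f zero    = refl
sumBelow≡sum f (suc n) = trans (sumBelow-suc f n) (cong (λ s → f 0 + s) (sumBelow≡sum (λ i → f (suc i)) n))

×≡pos* : ∀ n x → n × x ≡ + n * x
×≡pos* zero    x = sym (*-zeroˡ x)
×≡pos* (suc n) x = trans (cong (λ s → x + s) (×≡pos* n x))
  (solve 2 (λ x y → x :+ y :* x := (con (+ 1) :+ y) :* x) refl x (+ n))

^ₛ≡^ : ∀ x n → x ^ₛ n ≡ x ^ n
^ₛ≡^ x zero    = refl
^ₛ≡^ x (suc n) = cong (x *_) (^ₛ≡^ x n)

pos-^ : ∀ a n → + (a ^ℕ n) ≡ (+ a) ^ n
pos-^ a zero    = refl
pos-^ a (suc n) = trans (pos-* a (a ^ℕ n)) (cong (+ a *_) (pos-^ a n))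

-‿^ : ∀ x n → (- x) ^ n ≡ sign n * x ^ n
-‿^ x zero    = refl
-‿^ x (suc n) = trans (cong ((- x) *_) (-‿^ x n))
  (solve 3 (λ x s p → (:- x) :* (s :* p) := (:- s) :* (x :* p)) refl x (sign n) (x ^ n))

binomial : ∀ m x y → (x + y) ^ m ≡ sumBelow (λ k → + (m C k) * (x ^ k * y ^ (m ∸ k))) (suc m)
binomial m x y = begin
  (x + y) ^ m                 ≡⟨ sym (^ₛ≡^ (x + y) m) ⟩
  (x + y) ^ₛ m                ≡⟨ Binomial.theorem m x y ⟩
  Binomial.binomialExpansion x y m
    ≡⟨ sum-cong-≗ {suc m} (λ k → trans (×≡pos* (m C toℕ k) _) (cong (+ (m C toℕ k) *_) (cong₂ _*_ (^ₛ≡^ x (toℕ k)) (^ₛ≡^ y (m ∸ toℕ k))))) ⟩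
  sum {suc m} (λ k → + (m C toℕ k) * (x ^ toℕ k * y ^ (m ∸ toℕ k))) ≡⟨ sym (sumBelow≡sum _ (suc m)) ⟩
  sumBelow (λ k → + (m C k) * (x ^ k * y ^ (m ∸ k))) (suc m) ∎

binomial-∸ : ∀ m {N b} → b ≤ N →
  + ((N ∸ b) ^ℕ m) ≡ sumBelow (λ k → sign k * + (m C k) * (+ (N ^ℕ (m ∸ k)) * + (b ^ℕ k))) (suc m)
binomial-∸ m {N} {b} b≤N = begin
  + ((N ∸ b) ^ℕ m)     ≡⟨ pos-^ (N ∸ b) m ⟩
  (+ (N ∸ b)) ^ m      ≡⟨ cong (_^ m) (sym (trans (-m+n≡n⊖m b N) (⊖-≥ b≤N))) ⟩
  (- + b + + N) ^ m    ≡⟨ binomial m (- + b) (+ N) ⟩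
  sumBelow (λ k → + (m C k) * ((- + b) ^ k * (+ N) ^ (m ∸ k))) (suc m) ≡⟨ sumBelow-cong (suc m) (λ k _ → term k) ⟩
  sumBelow (λ k → sign k * + (m C k) * (+ (N ^ℕ (m ∸ k)) * + (b ^ℕ k))) (suc m) ∎
  where
  term : ∀ k → + (m C k) * ((- + b) ^ k * (+ N) ^ (m ∸ k)) ≡ sign k * + (m C k) * (+ (N ^ℕ (m ∸ k)) * + (b ^ℕ k))
  term k rewrite -‿^ (+ b) k | sym (pos-^ b k) | sym (pos-^ N (m ∸ k)) =
    solve 4 (λ c s p q → c :* (s :* p :* q) := s :* c :* (q :* p)) refl (+ (m C k)) (sign k) (+ (b ^ℕ k)) (+ (N ^ℕ (m ∸ k)))

sumBelow-∸^-expand : ∀ m N (T : ℕ → ℤ) →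
  sumBelow (λ b → + ((N ∸ b) ^ℕ m) * T b) N
    ≡ sumBelow (λ k → sign k * + (m C k) * (+ (N ^ℕ (m ∸ k)) * sumBelow (λ b → + (b ^ℕ k) * T b) N)) (suc m)
sumBelow-∸^-expand m N T = begin
  sumBelow (λ b → + ((N ∸ b) ^ℕ m) * T b) N
    ≡⟨ sumBelow-cong N (λ b b<N → trans (cong (_* T b) (binomial-∸ m (<⇒≤ b<N))) (*-distribʳ-sumBelow (T b) (A b) (suc m))) ⟩
  sumBelow (λ b → sumBelow (λ k → A b k * T b) (suc m)) N ≡⟨ sym (sumBelow-comm (λ k b → A b k * T b) (suc m) N) ⟩
  sumBelow (λ k → sumBelow (λ b → A b k * T b) N) (suc m) ≡⟨ sumBelow-cong (suc m) (λ k _ → sym (factor k)) ⟩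
  sumBelow (λ k → c k * (P k * sumBelow (λ b → + (b ^ℕ k) * T b) N)) (suc m) ∎
  where
  c : ℕ → ℤ
  c k = sign k * + (m C k)
  P : ℕ → ℤ
  P k = + (N ^ℕ (m ∸ k))
  A : ℕ → ℕ → ℤ
  A b k = c k * (P k * + (b ^ℕ k))
  factor : ∀ k → c k * (P k * sumBelow (λ b → + (b ^ℕ k) * T b) N) ≡ sumBelow (λ b → A b k * T b) N
  factor k = begin
    c k * (P k * sumBelow (λ b → + (b ^ℕ k) * T b) N)     ≡⟨ cong (c k *_) (*-distribˡ-sumBelow (P k) _ N) ⟩
    c k * sumBelow (λ b → P k * (+ (b ^ℕ k) * T b)) N     ≡⟨ *-distribˡ-sumBelow (c k) _ N ⟩
    sumBelow (λ b → c k * (P k * (+ (b ^ℕ k) * T b))) N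
      ≡⟨ sumBelow-cong N (λ b _ → trans (cong (c k *_) (sym (*-assoc (P k) _ (T b)))) (sym (*-assoc (c k) _ (T b)))) ⟩
    sumBelow (λ b → A b k * T b) N ∎

⊛-reverse : ∀ (f g : Series) N → f 0 ≡ + 0 → (f ⊛ g) N ≡ sumBelow (λ b → f (N ∸ b) * g b) N
⊛-reverse f g N f0≡0 = begin
  sumBelow (λ a → f a * g (N ∸ a)) (suc N)                               ≡⟨ sumBelow-reverse _ N ⟩
  sumBelow (λ b → f (N ∸ b) * g (N ∸ (N ∸ b))) N + f (N ∸ N) * g (N ∸ (N ∸ N))
    ≡⟨ cong₂ _+_ (sumBelow-cong N (λ b b<N → cong (λ i → f (N ∸ b) * g i) (m∸[m∸n]≡n (<⇒≤ b<N)))) lastTerm ⟩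
  sumBelow (λ b → f (N ∸ b) * g b) N + + 0                               ≡⟨ +-identityʳ _ ⟩
  sumBelow (λ b → f (N ∸ b) * g b) N                                     ∎
  where
  lastTerm : f (N ∸ N) * g (N ∸ (N ∸ N)) ≡ + 0
  lastTerm rewrite n∸n≡0 N | f0≡0 = refl

coeffLi-∷ : ∀ s w N → coeffLi (s ∷ w) N ≡ + (N ^ℕ s) * sumBelow (coeffLi w) N
coeffLi-∷ s w zero    = sym (*-zeroʳ (+ (0 ^ℕ s)))
coeffLi-∷ s w (suc N) = refl

sumBelow-coeffLi-[] : ∀ n → sumBelow (coeffLi []) (suc n) ≡ + 1
sumBelow-coeffLi-[] zero    = refl
sumBelow-coeffLi-[] (suc n) = trans (+-identityʳ _) (sumBelow-coeffLi-[] n)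

coeffLi-[_] : ∀ m {a} → 0 < a → coeffLi (m ∷ []) a ≡ + (a ^ℕ m)
coeffLi-[ m ] {suc a} _ = trans (cong (+ (suc a ^ℕ m) *_) (sumBelow-coeffLi-[] a)) (*-identityʳ _)

coeffLi-+ : ∀ s k w b → coeffLi ((s +ℕ k) ∷ w) b ≡ + (b ^ℕ k) * coeffLi (s ∷ w) b
coeffLi-+ s k w b = begin
  coeffLi ((s +ℕ k) ∷ w) b                       ≡⟨ coeffLi-∷ (s +ℕ k) w b ⟩
  + (b ^ℕ (s +ℕ k)) * H                          ≡⟨ cong (λ e → + e * H) (^-distribˡ-+-* b s k) ⟩
  + (b ^ℕ s ℕ* b ^ℕ k) * H                       ≡⟨ cong (_* H) (pos-* (b ^ℕ s) (b ^ℕ k)) ⟩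
  + (b ^ℕ s) * + (b ^ℕ k) * H                    ≡⟨ solve 3 (λ x y h → x :* y :* h := y :* (x :* h)) refl (+ (b ^ℕ s)) (+ (b ^ℕ k)) H ⟩
  + (b ^ℕ k) * (+ (b ^ℕ s) * H)                  ≡⟨ cong (+ (b ^ℕ k) *_) (sym (coeffLi-∷ s w b)) ⟩
  + (b ^ℕ k) * coeffLi (s ∷ w) b                 ∎
  where
  H = sumBelow (coeffLi w) b

theorem4p5 : ∀ (m r : ℕ) (w′ : Word) (N : ℕ) →
    (coeffLi (m ∷ []) ⊛ coeffLi (r ∷ w′)) N
      ≡ sumBelow (λ k → sign k * (+ (m C k)) * coeffLi ((m ∸ k) ∷ (r +ℕ k) ∷ w′) N) (suc m)
theorem4p5 m r w′ N = begin
  (coeffLi (m ∷ []) ⊛ T) N                           ≡⟨ ⊛-reverse (coeffLi (m ∷ [])) T N refl ⟩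
  sumBelow (λ b → coeffLi (m ∷ []) (N ∸ b) * T b) N
    ≡⟨ sumBelow-cong N (λ b b<N → cong (_* T b) (coeffLi-[ m ] (m<n⇒0<n∸m b<N))) ⟩
  sumBelow (λ b → + ((N ∸ b) ^ℕ m) * T b) N          ≡⟨ sumBelow-∸^-expand m N T ⟩
  sumBelow (λ k → sign k * + (m C k) * (+ (N ^ℕ (m ∸ k)) * sumBelow (λ b → + (b ^ℕ k) * T b) N)) (suc m)
    ≡⟨ sumBelow-cong (suc m) (λ k _ → cong (sign k * + (m C k) *_) (sym (coeffLi-∷-+ k))) ⟩
  sumBelow (λ k → sign k * (+ (m C k)) * coeffLi ((m ∸ k) ∷ (r +ℕ k) ∷ w′) N) (suc m) ∎
  where
  T : Series
  T = coeffLi (r ∷ w′)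
  coeffLi-∷-+ : ∀ k → coeffLi ((m ∸ k) ∷ (r +ℕ k) ∷ w′) N ≡ + (N ^ℕ (m ∸ k)) * sumBelow (λ b → + (b ^ℕ k) * T b) N
  coeffLi-∷-+ k = trans (coeffLi-∷ (m ∸ k) ((r +ℕ k) ∷ w′) N)
    (cong (+ (N ^ℕ (m ∸ k)) *_) (sumBelow-cong N (λ b _ → coeffLi-+ r k w′ b)))
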